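{- The property of being a connected Roman dominating function and the property of being a total Roman dominating function are both nice Roman domination properties.
   Context: Graphs are finite, simple and undirected; $N(v)$, $N[v]=N(v)\cup\{v\}$ are neighborhoods. In a graph $H$, for $A\subseteq V(H)$ and $v\in A$, $P_{H,A}(v)=N_H[v]\setminus N_H[A\setminus\{v\}]$. For $f:V\to\{0,1,2\}$, $V_i(f)=\{v: f(v)=i\}$; $\chi_S$ is the characteristic function of $S$. A Roman dominating function (Rdf) is an $f:V\to\{0,1,2\}$ such that each $v\in V_0(f)$ has a neighbor in $V_2(f)$. A total Roman dominating function is an Rdf $f$ such that every $v\in V_1(f)\cup V_2(f)$ has a neighbor in $V_1(f)\cup V_2(f)$; a connected Roman dominating function is an Rdf $f$ such that $G[V_1(f)\cup V_2(f)]$ is connected. A property $\mathcal{P}$ assigns to each graph a set of functions $V\to\{0,1,2\}$. $\mathcal{P}$ is a nice Roman domination property if for every graph $G=(V,E)$ and every $f$ with property $\mathcal{P}$: (1) $f$ is an Rdf; (2) for all $v\in V_0(f)$, $f+\chi_{\{v\}}$ has $\mathcal{P}$; (3) for all $v\in V_2(f)$, $f-\chi_{\{v\}}$ has $\mathcal{P}$ iff $P_{G[V\setminus V_1(f)],V_2(f)}(v)\subseteq\{v\}$. -}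

module Defs where

open import Data.Nat using (ℕ)
open import Data.Fin using (Fin; _≟_)
open import Data.Bool using (Bool; true; false)
open import Data.Product using (Σ; ∃; _×_; _,_)
open import Data.Sum using (_⊎_)
open import Relation.Nullary using (¬_; yes; no)
open import Relation.Binary.PropositionalEquality using (_≡_; _≢_)
open import Function.Bundles using (_⇔_)

record Graph : Set where
  field
    n      : ℕ
    adj    : Fin n → Fin n → Bool
    sym    : ∀ u v → adj u v ≡ adj v u
    irrefl : ∀ v → adj v v ≡ false

open Graph public

Adj : (G : Graph) → Fin (n G) → Fin (n G) → Set
Adj G u v = adj G u v ≡ true

data Val : Set where
  v0 v1 v2 : Val

Fn : Graph → Set
Fn G = Fin (n G) → Val

Property : Set₁
Property = (G : Graph) → Fn G → Set

-- f with the value at v replaced by 1.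
-- For f v = 0 this is f + χ_{v}; for f v = 2 this is f - χ_{v}.
set1 : (G : Graph) → Fn G → Fin (n G) → Fn G
set1 G f v w with w ≟ v
... | yes _ = v1
... | no  _ = f w

IsRdf : Property
IsRdf G f = ∀ v → f v ≡ v0 → ∃ λ w → Adj G v w × f w ≡ v2

Pos : (G : Graph) → Fn G → Fin (n G) → Set
Pos G f v = f v ≢ v0

IsTotalRdf : Property
IsTotalRdf G f = IsRdf G f × (∀ v → Pos G f v → ∃ λ w → Adj G v w × Pos G f w)

data WalkIn (G : Graph) (S : Fin (n G) → Set) : Fin (n G) → Fin (n G) → Set where
  here : ∀ {u} → S u → WalkIn G S u u
  step : ∀ {u x w} → S u → Adj G u x → WalkIn G S x w → WalkIn G S u w

-- the induced subgraph G[S] is connected (every two vertices of S are joined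
-- by a path within S; the empty graph counts as connected)
InducedConnected : (G : Graph) → (Fin (n G) → Set) → Set
InducedConnected G S = ∀ u w → S u → S w → WalkIn G S u w

IsConnectedRdf : Property
IsConnectedRdf G f = IsRdf G f × InducedConnected G (Pos G f)

InH : (G : Graph) → Fn G → Fin (n G) → Set
InH G f u = f u ≢ v1

InClosedNbhdH : (G : Graph) → Fn G → Fin (n G) → Fin (n G) → Set
InClosedNbhdH G f x u = InH G f u × InH G f x × (u ≡ x ⊎ Adj G u x)

-- u ∈ P_{H,A}(v) with H = G[V \ V_1(f)], A = V_2(f):
-- u ∈ N_H[v] and u ∉ N_H[A \ {v}]
InPrivate : (G : Graph) → Fn G → Fin (n G) → Fin (n G) → Set
InPrivate G f v u =
  InClosedNbhdH G f v u ×
  ¬ (∃ λ a → f a ≡ v2 × a ≢ v × InClosedNbhdH G f a u)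

PrivateSubsetSelf : (G : Graph) → Fn G → Fin (n G) → Set
PrivateSubsetSelf G f v = ∀ u → InPrivate G f v u → u ≡ v

IsNice : Property → Set
IsNice P =
  ∀ (G : Graph) (f : Fn G) → P G f →
    IsRdf G f
    × (∀ v → f v ≡ v0 → P G (set1 G f v))
    × (∀ v → f v ≡ v2 → (P G (set1 G f v) ⇔ PrivateSubsetSelf G f v))

-- Lowering a vertex v from 0 or 2 to 1 changes the support V₁ ∪ V₂ only by
-- possibly adding v.  Adding a vertex v ∈ V₀ keeps totality and connectivity
-- because v already has a neighbour in V₂ ⊆ support.  Lowering v ∈ V₂ leaves the
-- support unchanged, so only Roman domination can fail, and it fails exactly
-- when some vertex of V₀ is dominated by v alone, i.e. lies in the private
-- neighbourhood P(v) in G[V ∖ V₁].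
module Submission where

open import Defs
open import Data.Bool using (true)
import Data.Bool.Properties as Bool
open import Data.Empty using (⊥-elim)
open import Data.Fin using (Fin; _≟_)
open import Data.Fin.Properties using (any?)
open import Data.Product using (∃; _×_; _,_; proj₁)
open import Data.Sum using (_⊎_; inj₁; inj₂)
open import Function.Bundles using (_⇔_; mk⇔)
open import Relation.Nullary using (¬_; Dec; yes; no)
open import Relation.Nullary.Decidable using (_×-dec_; ¬?)
open import Relation.Binary.PropositionalEquality using (_≡_; _≢_; refl; trans)
import Relation.Binary.PropositionalEquality as ≡

private
  variable
    G : Graph

_≟v2 : (x : Val) → Dec (x ≡ v2)
v0 ≟v2 = no λ ()
v1 ≟v2 = no λ ()
v2 ≟v2 = yes refl

v2≢v0 : ∀ {x} → x ≡ v2 → x ≢ v0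
v2≢v0 refl ()

v2≢v1 : ∀ {x} → x ≡ v2 → x ≢ v1
v2≢v1 refl ()

v0≢v1 : ∀ {x} → x ≡ v0 → x ≢ v1
v0≢v1 refl ()

Adj-sym : ∀ {u w} → Adj G u w → Adj G w u
Adj-sym {G} {u} {w} = trans (Graph.sym G w u)

module _ {G : Graph} (f : Fn G) (v : Fin (n G)) where

  set1-≡ : set1 G f v v ≡ v1
  set1-≡ with v ≟ v
  ... | yes _  = refl
  ... | no v≢v = ⊥-elim (v≢v refl)

  Pos-set1-self : Pos G (set1 G f v) v
  Pos-set1-self gv≡v0 with trans (≡.sym set1-≡) gv≡v0
  ... | ()

  set1-≢ : ∀ {w} → w ≢ v → set1 G f v w ≡ f w
  set1-≢ {w} w≢v with w ≟ v
  ... | yes w≡v = ⊥-elim (w≢v w≡v)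
  ... | no _    = refl

  set1-v0 : ∀ {w} → set1 G f v w ≡ v0 → w ≢ v × f w ≡ v0
  set1-v0 {w} with w ≟ v
  ... | yes _ = λ ()
  ... | no w≢v = λ fw≡v0 → w≢v , fw≡v0

  Pos-set1⁺ : ∀ {w} → Pos G f w → Pos G (set1 G f v) w
  Pos-set1⁺ {w} fw≢v0 with w ≟ v
  ... | yes _ = λ ()
  ... | no _  = fw≢v0

  Pos-set1⁻ : ∀ {w} → Pos G (set1 G f v) w → Pos G f w ⊎ w ≡ v
  Pos-set1⁻ {w} gw≢v0 with w ≟ v
  ... | yes w≡v = inj₂ w≡v
  ... | no _    = inj₁ gw≢v0

  Pos-set1⁻-of-Pos : Pos G f v → ∀ {w} → Pos G (set1 G f v) w → Pos G f w
  Pos-set1⁻-of-Pos fv≢v0 pw with Pos-set1⁻ pw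
  ... | inj₁ fw≢v0 = fw≢v0
  ... | inj₂ refl  = fv≢v0

WalkIn-head : ∀ {S u w} → WalkIn G S u w → S u
WalkIn-head (here s)     = s
WalkIn-head (step s _ _) = s

WalkIn-map : ∀ {S T} → (∀ {x} → S x → T x) → ∀ {u w} → WalkIn G S u w → WalkIn G T u w
WalkIn-map h (here s)      = here (h s)
WalkIn-map h (step s a ws) = step (h s) a (WalkIn-map h ws)

WalkIn-reverse : ∀ {S u w} → WalkIn G S u w → WalkIn G S w u
WalkIn-reverse {G} ws = go ws (here (WalkIn-head ws))
  where
  go : ∀ {S a b c} → WalkIn G S a b → WalkIn G S a c → WalkIn G S b c
  go (here _)      acc = acc
  go (step s a ws) acc = go ws (step (WalkIn-head ws) (Adj-sym {G} a) acc)

InducedConnected-map : ∀ {S T} → (∀ {x} → S x → T x) → (∀ {x} → T x → S x) →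
                       InducedConnected G S → InducedConnected G T
InducedConnected-map S⊆T T⊆S conn u w tu tw = WalkIn-map S⊆T (conn u w (T⊆S tu) (T⊆S tw))

InducedConnected-extend :
  ∀ {S T v x} → InducedConnected G S → (∀ {y} → S y → T y) →
  (∀ {y} → T y → S y ⊎ y ≡ v) → T v → Adj G v x → S x →
  InducedConnected G T
InducedConnected-extend {G} {S} {T} {v} {x} conn S⊆T T⊆S+v tv v~x sx = connT
  where
  from-v : ∀ w → S w → WalkIn G T v w
  from-v w sw = step tv v~x (WalkIn-map S⊆T (conn x w sx sw))

  connT : InducedConnected G T
  connT u w tu tw with T⊆S+v tu | T⊆S+v tw
  ... | inj₁ su    | inj₁ sw    = WalkIn-map S⊆T (conn u w su sw)
  ... | inj₂ refl  | inj₁ sw    = from-v w sw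
  ... | inj₁ su    | inj₂ refl  = WalkIn-reverse (from-v u su)
  ... | inj₂ refl  | inj₂ refl  = here tu

IsRdf-set1-v0 : ∀ (f : Fn G) v → f v ≡ v0 → IsRdf G f → IsRdf G (set1 G f v)
IsRdf-set1-v0 f v fv≡v0 rdf u gu≡v0 with set1-v0 f v gu≡v0
... | u≢v , fu≡v0 with rdf u fu≡v0
... | w , u~w , fw≡v2 = w , u~w , trans (set1-≢ f v w≢v) fw≡v2
  where
  w≢v : w ≢ v
  w≢v refl = v2≢v0 fw≡v2 fv≡v0

module _ {G : Graph} (f : Fn G) (v : Fin (n G)) (fv≡v2 : f v ≡ v2) where

  IsRdf-set1⇒private : IsRdf G (set1 G f v) → PrivateSubsetSelf G f v
  IsRdf-set1⇒private rdf u ((hu , _ , u≡v⊎u~v) , no-other) with u ≟ v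
  ... | yes u≡v = u≡v
  ... | no u≢v with u≡v⊎u~v
  ... | inj₁ u≡v = ⊥-elim (u≢v u≡v)
  ... | inj₂ _ with f u in fu
  ... | v1 = ⊥-elim (hu refl)
  ... | v2 = ⊥-elim (no-other (u , fu , u≢v , (λ ()) , v2≢v1 fu , inj₁ refl))
  ... | v0 with rdf u (trans (set1-≢ f v u≢v) fu)
  ... | w , u~w , gw≡v2 = ⊥-elim (no-other (w , fw≡v2 , w≢v , hu , v2≢v1 fw≡v2 , inj₂ u~w))
    where
    w≢v : w ≢ v
    w≢v refl = v2≢v1 gw≡v2 (set1-≡ f v)
    fw≡v2 : f w ≡ v2
    fw≡v2 = trans (≡.sym (set1-≢ f v w≢v)) gw≡v2

  private⇒IsRdf-set1 : IsRdf G f → PrivateSubsetSelf G f v → IsRdf G (set1 G f v)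
  private⇒IsRdf-set1 rdf private⊆v u gu≡v0 with set1-v0 f v gu≡v0
  ... | u≢v , fu≡v0 with any? (λ a → (f a ≟v2) ×-dec ¬? (a ≟ v) ×-dec (adj G u a Bool.≟ true))
  ... | yes (a , fa≡v2 , a≢v , u~a) = a , u~a , trans (set1-≢ f v a≢v) fa≡v2
  ... | no no-other with rdf u fu≡v0
  ... | w , u~w , fw≡v2 with w ≟ v
  ... | no w≢v  = ⊥-elim (no-other (w , fw≡v2 , w≢v , u~w))
  ... | yes refl = ⊥-elim (u≢v (private⊆v u ((v0≢v1 fu≡v0 , v2≢v1 fv≡v2 , inj₂ u~w) , not-near-other)))
    where
    not-near-other : ¬ (∃ λ a → f a ≡ v2 × a ≢ w × InClosedNbhdH G f a u)
    not-near-other (a , fa≡v2 , a≢w , _ , _ , inj₁ refl) = v2≢v0 fa≡v2 fu≡v0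
    not-near-other (a , fa≡v2 , a≢w , _ , _ , inj₂ u~a)  = no-other (a , fa≡v2 , a≢w , u~a)

SupportInvariant : Property → Set
SupportInvariant Q = ∀ G (f g : Fn G) → (∀ {w} → Pos G f w → Pos G g w) →
                     (∀ {w} → Pos G g w → Pos G f w) → Q G f → Q G g

ClosedUnderRaising : Property → Set
ClosedUnderRaising Q = ∀ G (f : Fn G) v → f v ≡ v0 → IsRdf G f → Q G f → Q G (set1 G f v)

IsNice-Rdf× : ∀ Q → SupportInvariant Q → ClosedUnderRaising Q →
              IsNice (λ G f → IsRdf G f × Q G f)
IsNice-Rdf× Q invariant raise G f (rdf , q) = rdf , raise-v0 , lower-v2
  where
  raise-v0 : ∀ v → f v ≡ v0 → IsRdf G (set1 G f v) × Q G (set1 G f v)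
  raise-v0 v fv≡v0 = IsRdf-set1-v0 f v fv≡v0 rdf , raise G f v fv≡v0 rdf q

  lower-v2 : ∀ v → f v ≡ v2 →
             (IsRdf G (set1 G f v) × Q G (set1 G f v)) ⇔ PrivateSubsetSelf G f v
  lower-v2 v fv≡v2 = mk⇔
    (λ p → IsRdf-set1⇒private f v fv≡v2 (proj₁ p))
    (λ private⊆v → private⇒IsRdf-set1 f v fv≡v2 rdf private⊆v
                 , invariant G f (set1 G f v) (Pos-set1⁺ f v)
                     (Pos-set1⁻-of-Pos f v (v2≢v0 fv≡v2)) q)

IsTotalSupport : Property
IsTotalSupport G f = ∀ v → Pos G f v → ∃ λ w → Adj G v w × Pos G f w

IsConnectedSupport : Property
IsConnectedSupport G f = InducedConnected G (Pos G f)

IsTotalSupport-invariant : SupportInvariant IsTotalSupport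
IsTotalSupport-invariant G f g f⊆g g⊆f total u gu =
  let w , u~w , fw = total u (g⊆f gu) in w , u~w , f⊆g fw

IsTotalSupport-raise : ClosedUnderRaising IsTotalSupport
IsTotalSupport-raise G f v fv≡v0 rdf total u gu with Pos-set1⁻ f v gu
... | inj₁ fu with total u fu
...   | w , u~w , fw = w , u~w , Pos-set1⁺ f v fw
IsTotalSupport-raise G f v fv≡v0 rdf total u gu | inj₂ refl with rdf u fv≡v0
...   | w , u~w , fw≡v2 = w , u~w , Pos-set1⁺ f v (v2≢v0 fw≡v2)

IsConnectedSupport-invariant : SupportInvariant IsConnectedSupport
IsConnectedSupport-invariant G f g = InducedConnected-map

IsConnectedSupport-raise : ClosedUnderRaising IsConnectedSupport
IsConnectedSupport-raise G f v fv≡v0 rdf conn with rdf v fv≡v0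
... | x , v~x , fx≡v2 =
  InducedConnected-extend conn (Pos-set1⁺ f v) (Pos-set1⁻ f v)
    (Pos-set1-self f v) v~x (v2≢v0 fx≡v2)

theorem4 : IsNice IsConnectedRdf × IsNice IsTotalRdf
theorem4 = IsNice-Rdf× IsConnectedSupport IsConnectedSupport-invariant IsConnectedSupport-raise
         , IsNice-Rdf× IsTotalSupport IsTotalSupport-invariant IsTotalSupport-raise
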